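{- Let $d\ge1$ and $k\ge0$, $n=dk+1$. The map $T\mapsto\vec a(T)$ from the set of $d$-parking trees on $n$ vertices to the set of $d$-parking functions of length $k$ is a bijection, where $\vec a(T)=(a_1,\dots,a_k)$ with $a_i=\omega(p_i)$, $p_i$ being the common parent of the vertices labeled $i_1,\dots,i_d$ and $\omega$ the depth-first search ordering of $T$ using $[1,n]$.
   Context: A $d$-parking tree is a rooted plane tree on $n=dk+1$ vertices in which the number of children of each vertex is a multiple of $d$, with vertex labels satisfying: (1) the root is labeled $\infty$; (2) every other vertex has a label $i_j$ with $i\in\{1,\dots,k\}$, $j\in\{1,\dots,d\}$; (3) for each fixed $i$, the vertices $i_1,\dots,i_d$ are children of a common parent and are consecutive in the left-to-right order of its children, in this order; (4) each $i\in\{1,\dots,k\}$ labels exactly one such $d$-element set of siblings; (5) if $i_j$ and $i'_{j'}$ are children of the same vertex and $i<i'$, then $i_j$ is to the right of $i'_{j'}$. Depth-first search ordering of a plane tree $T$ on $n$ vertices using $[a,a+n-1]$: the root gets $a$; if the root's children in left-to-right order are $r_1,\dots,r_s$ with subtrees $T_1,\dots,T_s$, then $T_i$ is recursively ordered using the interval $[a+|T_1|+\cdots+|T_{i-1}|+1,\,a+|T_1|+\cdots+|T_i|]$ (preorder numbering). A $d$-parking function of length $k$ is a list $(a_1,\dots,a_k)$ of positive integers whose nondecreasing rearrangement satisfies $a_{(i)}\le d(i-1)+1$ for all $i$. -}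

module Defs where

open import Data.Nat using (ℕ; zero; suc; _+_; _*_; _≤_; _<_)
open import Data.Nat.Divisibility using (_∣_)
open import Data.Fin as Fin using (Fin; toℕ)
open import Data.List using (List; []; _∷_; _++_; length; lookup; filter)
open import Data.Bool.ListAction using (any)
open import Data.List.Membership.Propositional using (_∈_)
open import Data.List.Relation.Unary.Linked using (Linked)
open import Data.List.Relation.Unary.All using (All)
open import Data.List.Relation.Binary.Permutation.Propositional using (_↭_)
open import Data.Vec using (Vec; tabulate; toList)
open import Data.Maybe using (Maybe; just; nothing)
open import Data.Maybe.Properties as MaybeP using ()
open import Data.Product using (Σ; _×_; _,_)
open import Data.Product.Properties as ProdP using ()
open import Data.Bool using (Bool; true; false; if_then_else_)
open import Relation.Nullary using (¬_)
open import Relation.Nullary.Decidable using (⌊_⌋)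
open import Relation.Binary.PropositionalEquality using (_≡_)

-- Rooted plane trees whose vertices carry labels from L.
-- The children of a vertex are listed left to right.

data PTree (L : Set) : Set where
  node : L → List (PTree L) → PTree L

module _ {L : Set} where

  label : PTree L → L
  label (node l _) = l

  children : PTree L → List (PTree L)
  children (node _ ts) = ts

  -- all vertices (as subtrees rooted at them) in depth-first (pre)order;
  -- the vertex at position m (0-based) has DFS number ω = m + 1
  mutual
    preorder : PTree L → List (PTree L)
    preorder (node l ts) = node l ts ∷ preorders ts

    preorders : List (PTree L) → List (PTree L)
    preorders [] = []
    preorders (t ∷ ts) = preorder t ++ preorders ts

-- 0-based index of the first element satisfying p (length of list if none)
firstIndex : {A : Set} → (A → Bool) → List A → ℕ
firstIndex p [] = zero
firstIndex p (x ∷ xs) = if p x then zero else suc (firstIndex p xs)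

-- Labels: nothing = ∞ (the root); just (i , j) = i_j with
-- i ∈ Fin k (standing for 1..k) and j ∈ Fin d (standing for 1..d).

Label : ℕ → ℕ → Set
Label d k = Maybe (Fin k × Fin d)

LTree : ℕ → ℕ → Set
LTree d k = PTree (Label d k)

_≟L_ : {d k : ℕ} → (x y : Label d k) → _
_≟L_ = MaybeP.≡-dec (ProdP.≡-dec Fin._≟_ Fin._≟_)

countLabel : {d k : ℕ} → LTree d k → Label d k → ℕ
countLabel T x = length (filter (λ v → label v ≟L x) (preorder T))

record IsParkingTree (d k : ℕ) (T : LTree d k) : Set where
  field
    size        : length (preorder T) ≡ d * k + 1
    childrenDiv : ∀ v → v ∈ preorder T → d ∣ length (children v)
    rootLabel   : label T ≡ nothing
    nonRootLabel : ∀ v → v ∈ preorder T → ∀ c → c ∈ children v → ¬ (label c ≡ nothing)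
    labelOnce   : ∀ (i : Fin k) (j : Fin d) → countLabel T (just (i , j)) ≡ 1
    -- (3) i_1,…,i_d are consecutive siblings in this order:
    --     the child right after i_j is i_{j+1} (for j < d)
    consecutive : ∀ v → v ∈ preorder T →
                  ∀ (p : Fin (length (children v))) (i : Fin k) (j j' : Fin d) →
                  label (lookup (children v) p) ≡ just (i , j) →
                  toℕ j' ≡ suc (toℕ j) →
                  Σ (Fin (length (children v))) λ q →
                    (toℕ q ≡ suc (toℕ p)) × (label (lookup (children v) q) ≡ just (i , j'))
    ordering    : ∀ v → v ∈ preorder T →
                  ∀ (p q : Fin (length (children v))) (i i' : Fin k) (j j' : Fin d) →
                  label (lookup (children v) p) ≡ just (i , j) →
                  label (lookup (children v) q) ≡ just (i' , j') →
                  toℕ i < toℕ i' → toℕ q < toℕ p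

record IsParkingFunction (d k : ℕ) (a : Vec ℕ k) : Set where
  field
    positive : All (λ x → 1 ≤ x) (toList a)
    sorted   : List ℕ
    sortedPerm : sorted ↭ toList a
    sortedNondecr : Linked _≤_ sorted
    bound    : ∀ (i : Fin (length sorted)) → lookup sorted i ≤ d * toℕ i + 1

isBlockOf : {d k : ℕ} → Fin k → Label d k → Bool
isBlockOf i nothing = false
isBlockOf i (just (i' , _)) = ⌊ i Fin.≟ i' ⌋

hasChildBlock : {d k : ℕ} → Fin k → LTree d k → Bool
hasChildBlock i v = any (λ c → isBlockOf i (label c)) (children v)

parentDFS : {d k : ℕ} → LTree d k → Fin k → ℕ
parentDFS T i = suc (firstIndex (hasChildBlock i) (preorder T))

toParkingFunction : {d k : ℕ} → LTree d k → Vec ℕ k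
toParkingFunction T = tabulate (parentDFS T)

module Submission where

-- Encode a plane tree by the list, in preorder, of the label lists of the children of its vertices.
-- A tree is determined by its root label and this list, and a list of label lists encodes a tree
-- exactly when its out-degree sequence is a Łukasiewicz word: it sums to n − 1, and its first m
-- entries sum to at least m for every m < n.
-- In a d-parking tree with parking function a, the children of the vertex with DFS number m are
-- forced: the blocks i with a_i = m, by decreasing i, each listed as i_1 … i_d. Hence the tree is
-- determined by a, and the first m out-degrees sum to d · #{i : a_i ≤ m}. The Łukasiewicz condition
-- thus becomes m ≤ d · #{i : a_i ≤ m} for m ≤ dk, which is the parking condition for a; conversely,
-- building the tree from these forced sibling lists turns every d-parking function into a parking tree.

open import Defs
open import Data.Bool as Bool using (Bool; true; false; if_then_else_)
open import Data.Bool.ListAction using (any; or)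
open import Data.Empty using (⊥-elim)
open import Data.Fin as Fin using (Fin; zero; suc; toℕ; fromℕ<)
open import Data.Fin.Properties using (toℕ-injective; toℕ<n; toℕ-fromℕ<)
open import Data.List
  using (List; []; _∷_; _++_; [_]; length; map; concat; concatMap; filter; lookup; take; drop; applyUpTo; allFin; zipWith)
open import Data.List.Properties
  using ( length-++; length-map; length-tabulate; length-take; length-drop; length-applyUpTo; map-++; map-∘; map-tabulate
        ; ++-assoc; ++-identityʳ; ∷-injective; concat-map; concat-++; concatMap-++; take-map; take-all; take++drop≡id
        ; applyUpTo-∷ʳ; filter-++; filter-accept; filter-reject; filter-all; filter-none; filter-some; filter-complete
        ; filter-≐; length-filter)
open import Data.List.Membership.Propositional using (_∈_; lose; find)
open import Data.List.Membership.Propositional.Properties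
  using ( ∈-lookup; ∈-map⁺; ∈-map⁻; ∈-++⁺ˡ; ∈-++⁺ʳ; ∈-allFin; ∈-concatMap⁺; ∈-concatMap⁻
        ; ∈-filter⁺; ∈-filter⁻; ∈-applyUpTo⁻)
open import Data.List.Relation.Binary.Permutation.Propositional
  using (_↭_; ↭-refl; ↭-sym; ↭-reflexive; prep; module PermutationReasoning)
open import Data.List.Relation.Binary.Permutation.Propositional.Properties
  using (↭-length; filter-↭; All-resp-↭; shift; shifts; ++⁺; ++⁺ʳ; ++-comm)
open import Data.List.Relation.Unary.All as All using (All; []; _∷_)
import Data.List.Relation.Unary.All.Properties as Allₚ
open import Data.List.Relation.Unary.AllPairs as AllPairs using (AllPairs; []; _∷_)
import Data.List.Relation.Unary.AllPairs.Properties as AllPairsₚ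
open import Data.List.Relation.Unary.Any as Any using (Any; here; there)
import Data.List.Relation.Unary.Any.Properties as Anyₚ
open import Data.List.Relation.Unary.Linked.Properties using (Linked⇒AllPairs)
import Data.List.Sort as Sort
open import Data.Maybe using (just; nothing)
open import Data.Nat using (ℕ; zero; suc; _+_; _∸_; _*_; _≤_; _<_; z≤n; s≤s; _≟_; _≤?_; _<?_; >-nonZero)
open import Data.Nat.Divisibility using (_∣_; m∣m*n)
open import Data.Nat.ListAction using (sum)
open import Data.Nat.Properties
open import Data.Nat.Solver using (module +-*-Solver)
open +-*-Solver using (solve; _:=_; _:+_)
open import Data.Product using (Σ; _×_; _,_; proj₁; proj₂)
open import Data.Unit using (tt)
open import Data.Vec using (Vec; toList)
import Data.Vec as Vec
open import Data.Vec.Properties using (length-toList; lookup∘tabulate; tabulate∘lookup; tabulate-cong)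
open import Function using (_∘_; id; case_of_)
open import Relation.Binary.Definitions using (Asymmetric; DecidableEquality; tri<; tri≈; tri>)
open import Relation.Binary.PropositionalEquality
  using (_≡_; _≢_; refl; sym; trans; cong; cong₂; subst; subst₂; module ≡-Reasoning)
open import Relation.Nullary using (¬_; yes; no; does)
open import Relation.Nullary.Decidable using (toWitness; fromWitness)
open import Relation.Unary using (Decidable)

private variable
  X Y : Set

module _ {P : X → Set} (P? : Decidable P) where

  count : List X → ℕ
  count xs = length (filter P? xs)

  count-++ : ∀ xs ys → count (xs ++ ys) ≡ count xs + count ys
  count-++ xs ys = trans (cong length (filter-++ P? xs ys)) (length-++ (filter P? xs))

  count-↭ : ∀ {xs ys} → xs ↭ ys → count xs ≡ count ys
  count-↭ = ↭-length ∘ filter-↭ P?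

  count-map : (f : Y → X) (ys : List Y) → count (map f ys) ≡ length (filter (P? ∘ f) ys)
  count-map f [] = refl
  count-map f (y ∷ ys) with does (P? (f y))
  ... | true = cong suc (count-map f ys)
  ... | false = count-map f ys

  count-∷-≥ : ∀ x xs → count xs ≤ count (x ∷ xs)
  count-∷-≥ x xs = subst (count xs ≤_) (sym (count-++ [ x ] xs)) (m≤n+m _ _)

  count-∷-≤ : ∀ x xs → count (x ∷ xs) ≤ suc (count xs)
  count-∷-≤ x xs with does (P? x)
  ... | true = ≤-refl
  ... | false = n≤1+n _

  count-lookup>0 : ∀ xs {p} → P (lookup xs p) → 0 < count xs
  count-lookup>0 xs {p} Pp = filter-some P? (lose (∈-lookup {xs = xs} p) Pp)

  count>0⇒Any : ∀ xs → 0 < count xs → Any P xs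
  count>0⇒Any (x ∷ xs) c with P? x
  ... | yes Px = here Px
  ... | no _ = there (count>0⇒Any xs c)

  count≥length⇒All : ∀ xs → length xs ≤ count xs → All P xs
  count≥length⇒All xs len≤ =
    subst (All P) (filter-complete P? (≤-antisym (length-filter P? xs) len≤)) (Allₚ.all-filter P? xs)

  count-≤-concatMap : (f : Y → List X) (ys : List Y) {u : Fin (length ys)} →
                      count (f (lookup ys u)) ≤ count (concatMap f ys)
  count-≤-concatMap f (y ∷ ys) {zero} rewrite count-++ (f y) (concatMap f ys) = m≤m+n _ _
  count-≤-concatMap f (y ∷ ys) {suc u} rewrite count-++ (f y) (concatMap f ys) =
    ≤-trans (count-≤-concatMap f ys) (m≤n+m _ _)

  lookup-unique : ∀ xs {p q} → count xs ≤ 1 → P (lookup xs p) → P (lookup xs q) → p ≡ q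
  lookup-unique (x ∷ xs) {zero} {zero} _ _ _ = refl
  lookup-unique (x ∷ xs) {zero} {suc q} c Px Pq rewrite filter-accept P? {xs = xs} Px =
    ⊥-elim (<-irrefl refl (≤-trans (s≤s (count-lookup>0 xs Pq)) c))
  lookup-unique (x ∷ xs) {suc p} {zero} c Pp Px = sym (lookup-unique (x ∷ xs) {zero} {suc p} c Px Pp)
  lookup-unique (x ∷ xs) {suc p} {suc q} c Pp Pq = cong suc (lookup-unique xs (≤-trans (count-∷-≥ x xs) c) Pp Pq)

  concatMap-lookup-unique : (f : Y → List X) (ys : List Y) {u u' : Fin (length ys)}
    {p : Fin (length (f (lookup ys u)))} {p' : Fin (length (f (lookup ys u')))} →
    count (concatMap f ys) ≤ 1 → P (lookup (f (lookup ys u)) p) → P (lookup (f (lookup ys u')) p') → u ≡ u'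
  concatMap-lookup-unique f (y ∷ ys) {zero} {zero} _ _ _ = refl
  concatMap-lookup-unique f (y ∷ ys) {zero} {suc u'} c Pp Pp' rewrite count-++ (f y) (concatMap f ys) =
    ⊥-elim (<-irrefl refl (≤-trans (+-mono-≤ (count-lookup>0 (f y) Pp)
      (≤-trans (count-lookup>0 (f (lookup ys u')) Pp') (count-≤-concatMap f ys {u'}))) c))
  concatMap-lookup-unique f (y ∷ ys) {suc u} {zero} c Pp Pp' =
    sym (concatMap-lookup-unique f (y ∷ ys) {zero} {suc u} c Pp' Pp)
  concatMap-lookup-unique f (y ∷ ys) {suc u} {suc u'} c Pp Pp' rewrite count-++ (f y) (concatMap f ys) =
    cong suc (concatMap-lookup-unique f ys (≤-trans (m≤n+m _ _) c) Pp Pp')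

∈-map-lookup⁻ : (f : X → Y) {xs : List X} {y : Y} → y ∈ map f xs → Σ (Fin (length xs)) λ p → f (lookup xs p) ≡ y
∈-map-lookup⁻ f {x ∷ xs} (here refl) = zero , refl
∈-map-lookup⁻ f {x ∷ xs} (there y∈) with ∈-map-lookup⁻ f y∈
... | p , fp≡y = suc p , fp≡y

firstIndex-map : {p : Y → Bool} {q : X → Bool} (f : X → Y) (xs : List X) → (∀ x → q x ≡ p (f x)) →
                 firstIndex q xs ≡ firstIndex p (map f xs)
firstIndex-map f [] q≗p∘f = refl
firstIndex-map {p = p} f (x ∷ xs) q≗p∘f rewrite q≗p∘f x =
  cong (λ r → if p (f x) then zero else suc r) (firstIndex-map f xs q≗p∘f)

firstIndex-applyUpTo : (p : X → Bool) (f : ℕ → X) {n w : ℕ} → w < n → Bool.T (p (f w)) →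
                       (∀ {u} → u < w → ¬ Bool.T (p (f u))) → firstIndex p (applyUpTo f n) ≡ w
firstIndex-applyUpTo p f {suc n} {zero} _ pw _ with p (f zero)
... | true = refl
firstIndex-applyUpTo p f {suc n} {suc w} (s≤s w<n) pw earlier with p (f zero) | earlier {zero} (s≤s z≤n)
... | true | ¬p0 = ⊥-elim (¬p0 tt)
... | false | _ = cong suc (firstIndex-applyUpTo p (f ∘ suc) w<n pw (earlier ∘ s≤s))

take-applyUpTo : (f : ℕ → X) {m n : ℕ} → m ≤ n → take m (applyUpTo f n) ≡ applyUpTo f m
take-applyUpTo f {zero} _ = refl
take-applyUpTo f {suc m} {suc n} (s≤s m≤n) = cong (f zero ∷_) (take-applyUpTo (f ∘ suc) m≤n)

applyUpTo-cong : {f g : ℕ → X} → (∀ w → f w ≡ g w) → ∀ n → applyUpTo f n ≡ applyUpTo g n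
applyUpTo-cong f≗g zero = refl
applyUpTo-cong f≗g (suc n) = cong₂ _∷_ (f≗g zero) (applyUpTo-cong (f≗g ∘ suc) n)

map≡applyUpTo : (f : X → Y) (g : ℕ → Y) (xs : List X) → (∀ w → f (lookup xs w) ≡ g (toℕ w)) →
                map f xs ≡ applyUpTo g (length xs)
map≡applyUpTo f g [] _ = refl
map≡applyUpTo f g (x ∷ xs) fx≡g = cong₂ _∷_ (fx≡g zero) (map≡applyUpTo f (g ∘ suc) xs (fx≡g ∘ suc))

sum-map-length : (xss : List (List X)) → sum (map length xss) ≡ length (concat xss)
sum-map-length [] = refl
sum-map-length (xs ∷ xss) = trans (cong (length xs +_) (sum-map-length xss)) (sym (length-++ xs))

All-lookup⁺ : {P : X → Set} (xs : List X) → (∀ p → P (lookup xs p)) → All P xs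
All-lookup⁺ [] _ = []
All-lookup⁺ (x ∷ xs) P-lookup = P-lookup zero ∷ All-lookup⁺ xs (P-lookup ∘ suc)

module _ {R : X → X → Set} where

  AllPairs-lookup⁺ : (xs : List X) → (∀ {p q} → toℕ p < toℕ q → R (lookup xs p) (lookup xs q)) → AllPairs R xs
  AllPairs-lookup⁺ [] _ = []
  AllPairs-lookup⁺ (x ∷ xs) R-lookup =
    All-lookup⁺ xs (λ q → R-lookup {zero} {suc q} (s≤s z≤n)) ∷ AllPairs-lookup⁺ xs (R-lookup ∘ s≤s)

  AllPairs-lookup⁻ : ∀ {xs} → AllPairs R xs → ∀ {p q} → toℕ p < toℕ q → R (lookup xs p) (lookup xs q)
  AllPairs-lookup⁻ (x<xs ∷ _) {zero} {suc q} _ = All.lookup x<xs (∈-lookup q)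
  AllPairs-lookup⁻ (_ ∷ sorted) {suc p} {suc q} (s≤s p<q) = AllPairs-lookup⁻ sorted p<q

  module _ (irrefl : ∀ {x} → ¬ R x x) (asym : Asymmetric R) where

    AllPairs-lookup-< : ∀ {xs} → AllPairs R xs → ∀ {p q} → R (lookup xs p) (lookup xs q) → toℕ p < toℕ q
    AllPairs-lookup-< sorted {p} {q} r with <-cmp (toℕ p) (toℕ q)
    ... | tri< p<q _ _ = p<q
    ... | tri≈ _ p≡q _ rewrite toℕ-injective p≡q = ⊥-elim (irrefl r)
    ... | tri> _ _ q<p = ⊥-elim (asym r (AllPairs-lookup⁻ sorted q<p))

    AllPairs-lookup-adjacent : ∀ {xs} → AllPairs R xs → ∀ {p q} → R (lookup xs p) (lookup xs q) →
                               (∀ {z} → R (lookup xs p) z → ¬ R z (lookup xs q)) → toℕ q ≡ suc (toℕ p)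
    AllPairs-lookup-adjacent sorted {p} {q} r nothing-between with <-cmp (toℕ q) (suc (toℕ p))
    ... | tri< q<1+p _ _ = ⊥-elim (<⇒≱ (AllPairs-lookup-< sorted r) (≤-pred q<1+p))
    ... | tri≈ _ q≡1+p _ = q≡1+p
    ... | tri> _ _ 1+p<q =
      ⊥-elim (nothing-between (AllPairs-lookup⁻ sorted {p} {s} p<s) (AllPairs-lookup⁻ sorted {s} {q} s<q))
      where
      s = fromℕ< (<-trans 1+p<q (toℕ<n q))
      p<s : toℕ p < toℕ s
      p<s = subst (toℕ p <_) (sym (toℕ-fromℕ< _)) (n<1+n _)
      s<q : toℕ s < toℕ q
      s<q = subst (_< toℕ q) (sym (toℕ-fromℕ< _)) 1+p<q

    sorted-≡ : ∀ {xs ys} → AllPairs R xs → AllPairs R ys →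
               (∀ {z} → z ∈ xs → z ∈ ys) → (∀ {z} → z ∈ ys → z ∈ xs) → xs ≡ ys
    sorted-≡ {[]} {[]} _ _ _ _ = refl
    sorted-≡ {[]} {y ∷ ys} _ _ _ ys⊆xs with () ← ys⊆xs (here refl)
    sorted-≡ {x ∷ xs} {[]} _ _ xs⊆ys _ with () ← xs⊆ys (here refl)
    sorted-≡ {x ∷ xs} {y ∷ ys} (x<xs ∷ sxs) (y<ys ∷ sys) xs⊆ys ys⊆xs with xs⊆ys (here refl) | ys⊆xs (here refl)
    ... | here refl | _ = cong (x ∷_) (sorted-≡ sxs sys (tail-⊆ x<xs xs⊆ys) (tail-⊆ y<ys ys⊆xs))
      where
      tail-⊆ : ∀ {x us vs} → All (R x) us → (∀ {z} → z ∈ x ∷ us → z ∈ x ∷ vs) →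
               ∀ {z} → z ∈ us → z ∈ vs
      tail-⊆ x<us ⊆ z∈us with ⊆ (there z∈us)
      ... | here refl = ⊥-elim (irrefl (All.lookup x<us z∈us))
      ... | there z∈vs = z∈vs
    ... | there x∈ys | here refl = ⊥-elim (irrefl (All.lookup y<ys x∈ys))
    ... | there x∈ys | there y∈xs = ⊥-elim (asym (All.lookup y<ys x∈ys) (All.lookup x<xs y∈xs))

  count-sorted-∈ : (∀ {x} → ¬ R x x) → (_≟_ : DecidableEquality X) → ∀ {x xs} → AllPairs R xs → x ∈ xs →
                   count (_≟ x) xs ≡ 1
  count-sorted-∈ irrefl _≟_ {x} (x<xs ∷ _) (here refl) with x ≟ x
  ... | yes _ =
    cong suc (cong length (filter-none (_≟ x) (All.map (λ R[x,y] y≡x → irrefl (subst (R x) y≡x R[x,y])) x<xs)))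
  ... | no x≢x = ⊥-elim (x≢x refl)
  count-sorted-∈ irrefl _≟_ {x} {y ∷ _} (y<xs ∷ sorted) (there x∈xs) with y ≟ x
  ... | yes refl = ⊥-elim (irrefl (All.lookup y<xs x∈xs))
  ... | no _ = count-sorted-∈ irrefl _≟_ sorted x∈xs

module _ (key : X → ℕ) where

  module _ (m : ℕ) where
    private
      atMost = λ x → key x ≤? m
      exactly = λ x → key x ≟ suc m
      atMost′ = λ x → key x ≤? suc m

    filter-≤-suc-↭ : ∀ xs → filter atMost xs ++ filter exactly xs ↭ filter atMost′ xs
    filter-≤-suc-↭ [] = ↭-refl
    filter-≤-suc-↭ (x ∷ xs) with <-cmp (key x) (suc m)
    ... | tri< x<1+m x≢1+m _ = begin
      filter atMost (x ∷ xs) ++ filter exactly (x ∷ xs)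
        ≡⟨ cong₂ _++_ (filter-accept atMost (≤-pred x<1+m)) (filter-reject exactly x≢1+m) ⟩
      x ∷ (filter atMost xs ++ filter exactly xs)         ↭⟨ prep x (filter-≤-suc-↭ xs) ⟩
      x ∷ filter atMost′ xs                               ≡⟨ filter-accept atMost′ (<⇒≤ x<1+m) ⟨
      filter atMost′ (x ∷ xs)                             ∎
      where open PermutationReasoning
    ... | tri≈ _ x≡1+m _ = begin
      filter atMost (x ∷ xs) ++ filter exactly (x ∷ xs)
        ≡⟨ cong₂ _++_ (filter-reject atMost (<⇒≱ (≤-reflexive (sym x≡1+m)))) (filter-accept exactly x≡1+m) ⟩
      filter atMost xs ++ x ∷ filter exactly xs           ↭⟨ shift x (filter atMost xs) (filter exactly xs) ⟩
      x ∷ (filter atMost xs ++ filter exactly xs)         ↭⟨ prep x (filter-≤-suc-↭ xs) ⟩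
      x ∷ filter atMost′ xs                               ≡⟨ filter-accept atMost′ (≤-reflexive x≡1+m) ⟨
      filter atMost′ (x ∷ xs)                             ∎
      where open PermutationReasoning
    ... | tri> _ x≢1+m 1+m<x = begin
      filter atMost (x ∷ xs) ++ filter exactly (x ∷ xs)
        ≡⟨ cong₂ _++_ (filter-reject atMost (<⇒≱ (<-trans (n<1+n m) 1+m<x))) (filter-reject exactly x≢1+m) ⟩
      filter atMost xs ++ filter exactly xs               ↭⟨ filter-≤-suc-↭ xs ⟩
      filter atMost′ xs                                   ≡⟨ filter-reject atMost′ (<⇒≱ 1+m<x) ⟨
      filter atMost′ (x ∷ xs)                             ∎
      where open PermutationReasoning

  concat-applyUpTo-filter-↭ : ∀ {xs} → All (λ x → 1 ≤ key x) xs → ∀ m →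
    concat (applyUpTo (λ w → filter (λ x → key x ≟ suc w) xs) m) ↭ filter (λ x → key x ≤? m) xs
  concat-applyUpTo-filter-↭ positive zero =
    ↭-reflexive (sym (filter-none (λ x → key x ≤? 0) (All.map <⇒≱ positive)))
  concat-applyUpTo-filter-↭ {xs} positive (suc m) = begin
    concat (applyUpTo group (suc m))              ≡⟨ cong concat (applyUpTo-∷ʳ group m) ⟨
    concat (applyUpTo group m ++ [ group m ])     ≡⟨ concat-++ (applyUpTo group m) [ group m ] ⟨
    concat (applyUpTo group m) ++ group m ++ []   ≡⟨ cong (concat (applyUpTo group m) ++_) (++-identityʳ (group m)) ⟩
    concat (applyUpTo group m) ++ group m         ↭⟨ ++⁺ʳ (group m) (concat-applyUpTo-filter-↭ positive m) ⟩
    filter (λ x → key x ≤? m) xs ++ group m       ↭⟨ filter-≤-suc-↭ m xs ⟩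
    filter (λ x → key x ≤? suc m) xs              ∎
    where
    open PermutationReasoning
    group : ℕ → List X
    group w = filter (λ x → key x ≟ suc w) xs

descendingFin : ∀ k → List (Fin k)
descendingFin zero = []
descendingFin (suc k) = map suc (descendingFin k) ++ [ zero ]

∈-descendingFin : ∀ {k} (i : Fin k) → i ∈ descendingFin k
∈-descendingFin {suc k} zero = ∈-++⁺ʳ (map suc (descendingFin k)) (here refl)
∈-descendingFin {suc k} (suc i) = ∈-++⁺ˡ (∈-map⁺ suc (∈-descendingFin i))

descendingFin-decreasing : ∀ k → AllPairs (λ i i' → toℕ i' < toℕ i) (descendingFin k)
descendingFin-decreasing zero = []
descendingFin-decreasing (suc k) =
  AllPairsₚ.++⁺ (AllPairsₚ.map⁺ (AllPairs.map s≤s (descendingFin-decreasing k))) ([] ∷ [])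
    (Allₚ.map⁺ (All.universal (λ _ → s≤s z≤n ∷ []) (descendingFin k)))

map-descendingFin-↭ : ∀ {k} (f : Fin k → X) → map f (descendingFin k) ↭ toList (Vec.tabulate f)
map-descendingFin-↭ {k = zero} f = ↭-refl
map-descendingFin-↭ {k = suc k} f = begin
  map f (map suc (descendingFin k) ++ [ zero ])    ≡⟨ map-++ f (map suc (descendingFin k)) [ zero ] ⟩
  map f (map suc (descendingFin k)) ++ [ f zero ]  ≡⟨ cong (_++ [ f zero ]) (map-∘ (descendingFin k)) ⟨
  map (f ∘ suc) (descendingFin k) ++ [ f zero ]    ↭⟨ ++⁺ʳ [ f zero ] (map-descendingFin-↭ (f ∘ suc)) ⟩
  toList (Vec.tabulate (f ∘ suc)) ++ [ f zero ]    ↭⟨ ++-comm (toList (Vec.tabulate (f ∘ suc))) [ f zero ] ⟩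
  toList (Vec.tabulate f)                          ∎
  where open PermutationReasoning

allFin-increasing : ∀ n → AllPairs (λ j j' → toℕ j < toℕ j') (allFin n)
allFin-increasing zero = []
allFin-increasing (suc n) = subst (λ js → AllPairs (λ j j' → toℕ j < toℕ j') (zero ∷ js)) (map-tabulate id suc)
  (Allₚ.map⁺ (All.universal (λ _ → s≤s z≤n) (allFin n))
    ∷ AllPairsₚ.map⁺ (AllPairs.map s≤s (allFin-increasing n)))

-- Plane trees and their Łukasiewicz codes

module _ {L : Set} where

  code : PTree L → List L
  code v = map label (children v)

  codes : PTree L → List (List L)
  codes T = map code (preorder T)

  forestCodes : List (PTree L) → List (List L)
  forestCodes ts = map code (preorders ts)

  -- the codes of node l cs, whatever the root label l
  rootlessCodes : List (PTree L) → List (List L)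
  rootlessCodes cs = map label cs ∷ forestCodes cs

  forestCodes-∷ : ∀ l cs ts → forestCodes (node l cs ∷ ts) ≡ map label cs ∷ forestCodes cs ++ forestCodes ts
  forestCodes-∷ l cs ts = cong (map label cs ∷_) (map-++ code (preorders cs) (preorders ts))

  forestCodes-∷-++ : ∀ l cs ts R →
    forestCodes (node l cs ∷ ts) ++ R ≡ map label cs ∷ forestCodes cs ++ (forestCodes ts ++ R)
  forestCodes-∷-++ l cs ts R =
    trans (cong (_++ R) (forestCodes-∷ l cs ts)) (cong (map label cs ∷_) (++-assoc (forestCodes cs) _ R))

  forestCodes-injective : ∀ ts ts' {R R'} → map label ts ≡ map label ts' →
                          forestCodes ts ++ R ≡ forestCodes ts' ++ R' → ts ≡ ts' × R ≡ R'
  forestCodes-injective [] [] _ R≡R' = refl , R≡R'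
  forestCodes-injective (node l cs ∷ ts) (node l' cs' ∷ ts') {R} {R'} labels≡ codes≡
    with ∷-injective labels≡
       | ∷-injective (trans (sym (forestCodes-∷-++ l cs ts R)) (trans codes≡ (forestCodes-∷-++ l' cs' ts' R')))
  ... | refl , ts-labels≡ | cs-labels≡ , rest≡ with forestCodes-injective cs cs' cs-labels≡ rest≡
  ... | refl , rest≡′ with forestCodes-injective ts ts' ts-labels≡ rest≡′
  ... | refl , R≡R' = refl , R≡R'

  codes-injective : ∀ T T' → label T ≡ label T' → codes T ≡ codes T' → T ≡ T'
  codes-injective (node l cs) (node l cs') refl codes≡ with ∷-injective codes≡
  ... | labels≡ , rest≡
    with forestCodes-injective cs cs' labels≡ (trans (++-identityʳ _) (trans rest≡ (sym (++-identityʳ _))))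
  ... | refl , _ = refl

  zipWith-node-labels : ∀ ls (css : List (List (PTree L))) → length ls ≡ length css →
                        map label (zipWith node ls css) ≡ ls
  zipWith-node-labels [] [] _ = refl
  zipWith-node-labels (l ∷ ls) (cs ∷ css) len≡ = cong (l ∷_) (zipWith-node-labels ls css (suc-injective len≡))

  zipWith-node-codes : ∀ ls css → length ls ≡ length css →
                       forestCodes (zipWith node ls css) ≡ concatMap rootlessCodes css
  zipWith-node-codes [] [] _ = refl
  zipWith-node-codes (l ∷ ls) (cs ∷ css) len≡ = trans (forestCodes-∷ l cs (zipWith node ls css))
    (cong (λ X → map label cs ∷ forestCodes cs ++ X) (zipWith-node-codes ls css (suc-injective len≡)))

  preorders-↭ : (ts : List (PTree L)) → preorders ts ↭ ts ++ concatMap children (preorders ts)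
  preorders-↭ [] = ↭-refl
  preorders-↭ (node l cs ∷ ts) = prep (node l cs) (begin
    preorders cs ++ preorders ts
      ↭⟨ ++⁺ (preorders-↭ cs) (preorders-↭ ts) ⟩
    (cs ++ concatMap children (preorders cs)) ++ (ts ++ concatMap children (preorders ts))
      ↭⟨ shifts (cs ++ concatMap children (preorders cs)) ts ⟩
    ts ++ (cs ++ concatMap children (preorders cs)) ++ concatMap children (preorders ts)
      ≡⟨ cong (ts ++_) (++-assoc cs _ _) ⟩
    ts ++ cs ++ concatMap children (preorders cs) ++ concatMap children (preorders ts)
      ≡⟨ cong (λ X → ts ++ cs ++ X) (concatMap-++ children (preorders cs) (preorders ts)) ⟨
    ts ++ cs ++ concatMap children (preorders cs ++ preorders ts)
      ∎)
    where open PermutationReasoning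

  preorder-↭ : (T : PTree L) → preorder T ↭ T ∷ concatMap children (preorder T)
  preorder-↭ (node l cs) = prep (node l cs) (preorders-↭ cs)

  map-label-children : (T : PTree L) → map label (concatMap children (preorder T)) ≡ concat (codes T)
  map-label-children T = trans (sym (concat-map (map children (preorder T)))) (cong concat (sym (map-∘ (preorder T))))

countLabel-children : ∀ {d k} (T : LTree d k) x → label T ≢ x →
                      countLabel T x ≡ count (λ c → label c ≟L x) (concatMap children (preorder T))
countLabel-children T x root≢x =
  trans (count-↭ (λ c → label c ≟L x) (preorder-↭ T))
        (cong length (filter-reject (λ c → label c ≟L x) {x = T} {xs = concatMap children (preorder T)} root≢x))

-- the number of trees of a forest whose preorder out-degree sequence is xs
treeCount : List ℕ → ℕ
treeCount [] = 0
treeCount (x ∷ xs) = suc (treeCount xs ∸ x)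

data Łukasiewicz : List ℕ → Set where
  [] : Łukasiewicz []
  _∷_ : ∀ {x xs} → x ≤ treeCount xs → Łukasiewicz xs → Łukasiewicz (x ∷ xs)

module _ {L : Set} where

  forestCodes-Łukasiewicz : ∀ (ts : List (PTree L)) R → Łukasiewicz (map length R) →
    Łukasiewicz (map length (forestCodes ts ++ R)) ×
    treeCount (map length (forestCodes ts ++ R)) ≡ length ts + treeCount (map length R)
  forestCodes-Łukasiewicz [] R ł = ł , refl
  forestCodes-Łukasiewicz (node l cs ∷ ts) R ł with forestCodes-Łukasiewicz ts R ł
  ... | łts , count-ts with forestCodes-Łukasiewicz cs (forestCodes ts ++ R) łts
  ... | łcs , count-cs =
    subst (λ Cs → Łukasiewicz (map length Cs) × treeCount (map length Cs) ≡ suc (length ts) + treeCount (map length R))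
      (sym (forestCodes-∷-++ l cs ts R)) (degree≤ ∷ łcs , cong suc count≡)
    where
    degree≤ : length (map label cs) ≤ treeCount (map length (forestCodes cs ++ (forestCodes ts ++ R)))
    degree≤ = subst₂ _≤_ (sym (length-map label cs)) (sym count-cs) (m≤m+n _ _)
    count≡ : treeCount (map length (forestCodes cs ++ (forestCodes ts ++ R))) ∸ length (map label cs)
             ≡ length ts + treeCount (map length R)
    count≡ = trans (cong₂ _∸_ count-cs (length-map label cs)) (trans (m+n∸m≡n (length cs) _) count-ts)

  codes-Łukasiewicz : (T : PTree L) → Łukasiewicz (map length (codes T)) × treeCount (map length (codes T)) ≡ 1
  codes-Łukasiewicz (node l cs) with forestCodes-Łukasiewicz cs [] []
  ... | łcs , count-cs =
    subst (λ Cs → Łukasiewicz (map length (map label cs ∷ Cs)) × treeCount (map length (map label cs ∷ Cs)) ≡ 1)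
      (++-identityʳ (forestCodes cs))
      (≤-reflexive (sym count≡) ∷ łcs ,
       cong suc (trans (cong (_∸ length (map label cs)) count≡) (n∸n≡0 (length (map label cs)))))
    where
    count≡ : treeCount (map length (forestCodes cs ++ [])) ≡ length (map label cs)
    count≡ = trans count-cs (trans (+-identityʳ (length cs)) (sym (length-map label cs)))

  buildForest : ∀ Cs → Łukasiewicz (map length Cs) →
    Σ (List (List (PTree L))) λ css → concatMap rootlessCodes css ≡ Cs × length css ≡ treeCount (map length Cs)
  buildForest [] [] = [] , refl , refl
  buildForest (C ∷ Cs) (C≤ ∷ ł) with buildForest Cs ł
  ... | css , codes≡ , length≡ =
    zipWith node C css₁ ∷ css₂ , codes-C∷Cs ,
    cong suc (trans (length-drop (length C) css) (cong (_∸ length C) length≡))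
    where
    css₁ = take (length C) css
    css₂ = drop (length C) css
    length-css₁ : length C ≡ length css₁
    length-css₁ = sym (trans (length-take (length C) css) (m≤n⇒m⊓n≡m (subst (length C ≤_) (sym length≡) C≤)))
    codes-C∷Cs : concatMap rootlessCodes (zipWith node C css₁ ∷ css₂) ≡ C ∷ Cs
    codes-C∷Cs = begin
      (map label (zipWith node C css₁) ∷ forestCodes (zipWith node C css₁)) ++ concatMap rootlessCodes css₂
        ≡⟨ cong₂ (λ X Y → (X ∷ Y) ++ concatMap rootlessCodes css₂)
                 (zipWith-node-labels C css₁ length-css₁) (zipWith-node-codes C css₁ length-css₁) ⟩
      C ∷ concatMap rootlessCodes css₁ ++ concatMap rootlessCodes css₂
        ≡⟨ cong (C ∷_) (concatMap-++ rootlessCodes css₁ css₂) ⟨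
      C ∷ concatMap rootlessCodes (css₁ ++ css₂)
        ≡⟨ cong (λ X → C ∷ concatMap rootlessCodes X) (take++drop≡id (length C) css) ⟩
      C ∷ concatMap rootlessCodes css
        ≡⟨ cong (C ∷_) codes≡ ⟩
      C ∷ Cs ∎
      where open ≡-Reasoning

  codes-surjective : ∀ Cs → Łukasiewicz (map length Cs) → treeCount (map length Cs) ≡ 1 →
                     (l : L) → Σ (PTree L) λ T → label T ≡ l × codes T ≡ Cs
  codes-surjective Cs ł one l with buildForest Cs ł
  ... | cs ∷ [] , codes≡ , _ = node l cs , refl , trans (sym (++-identityʳ _)) codes≡
  ... | [] , _ , length≡ with () ← trans length≡ one
  ... | _ ∷ _ ∷ _ , _ , length≡ with () ← trans length≡ one

Łukasiewicz⇒prefix : ∀ {xs r} → Łukasiewicz xs → treeCount xs ≡ suc r →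
                     ∀ m → m < length xs → m ≤ r + sum (take m xs)
Łukasiewicz⇒prefix _ _ zero _ = z≤n
Łukasiewicz⇒prefix {x ∷ []} _ _ (suc m) (s≤s ())
Łukasiewicz⇒prefix {x ∷ y ∷ ys} {r} (x≤ ∷ ł) count≡ (suc m) (s≤s m<len) = begin
  suc m            ≤⟨ s≤s (Łukasiewicz⇒prefix ł refl m m<len) ⟩
  suc r' + s       ≡⟨ cong (_+ s) count-ys≡ ⟩
  r + x + s        ≡⟨ +-assoc r x s ⟩
  r + (x + s)      ∎
  where
  open ≤-Reasoning
  r' = treeCount ys ∸ y
  s = sum (take m (y ∷ ys))
  count-ys≡ : suc r' ≡ r + x
  count-ys≡ = trans (sym (m∸n+n≡m x≤)) (cong (_+ x) (suc-injective count≡))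

prefix⇒Łukasiewicz : ∀ xs {r} → sum xs + suc r ≡ length xs →
                     (∀ m → m < length xs → m ≤ r + sum (take m xs)) → Łukasiewicz xs × treeCount xs ≡ suc r
prefix⇒Łukasiewicz [] ()
prefix⇒Łukasiewicz (x ∷ []) {r} total _ = ≤-reflexive x≡0 ∷ [] , cong suc (trans (0∸n≡0 x) (sym r≡0))
  where
  x+r≡0 : x + 0 + r ≡ 0
  x+r≡0 = suc-injective (trans (sym (+-suc (x + 0) r)) total)
  x≡0 : x ≡ 0
  x≡0 = trans (sym (+-identityʳ x)) (m+n≡0⇒m≡0 (x + 0) x+r≡0)
  r≡0 : r ≡ 0
  r≡0 = m+n≡0⇒n≡0 (x + 0) x+r≡0
prefix⇒Łukasiewicz (x ∷ y ∷ ys) {r} total prefix = extend (prefix⇒Łukasiewicz (y ∷ ys) {r'} total′ prefix′)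
  where
  r' = r + x ∸ 1
  suc-r'≡ : suc r' ≡ r + x
  suc-r'≡ = trans (+-comm 1 r') (m∸n+n≡m (subst (1 ≤_) (cong (r +_) (+-identityʳ x)) (prefix 1 (s≤s (s≤s z≤n)))))
  total′ : sum (y ∷ ys) + suc r' ≡ length (y ∷ ys)
  total′ = begin
    sum (y ∷ ys) + suc r'    ≡⟨ cong (sum (y ∷ ys) +_) suc-r'≡ ⟩
    sum (y ∷ ys) + (r + x)   ≡⟨ solve 3 (λ s r x → s :+ (r :+ x) := x :+ s :+ r) refl (sum (y ∷ ys)) r x ⟩
    x + sum (y ∷ ys) + r     ≡⟨ suc-injective (trans (sym (+-suc _ r)) total) ⟩
    length (y ∷ ys)          ∎
    where open ≡-Reasoning
  prefix′ : ∀ m → m < length (y ∷ ys) → m ≤ r' + sum (take m (y ∷ ys))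
  prefix′ m m<len = ≤-pred (subst (suc m ≤_) regroup (prefix (suc m) (s≤s m<len)))
    where
    regroup : r + (x + sum (take m (y ∷ ys))) ≡ suc r' + sum (take m (y ∷ ys))
    regroup = trans (sym (+-assoc r x _)) (cong (_+ sum (take m (y ∷ ys))) (sym suc-r'≡))
  extend : Łukasiewicz (y ∷ ys) × treeCount (y ∷ ys) ≡ suc r' →
           Łukasiewicz (x ∷ y ∷ ys) × treeCount (x ∷ y ∷ ys) ≡ suc r
  extend (ł , count≡) =
    subst (x ≤_) (sym count≡′) (m≤n+m x r) ∷ ł , cong suc (trans (cong (_∸ x) count≡′) (m+n∸n≡m r x))
    where
    count≡′ : treeCount (y ∷ ys) ≡ r + x
    count≡′ = trans count≡ suc-r'≡

ParkingCondition : ℕ → ℕ → List ℕ → Set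
ParkingCondition d k as = ∀ m → m ≤ d * k → m ≤ d * count (_≤? m) as

ParkingCondition-↭ : ∀ {d k as bs} → as ↭ bs → ParkingCondition d k as → ParkingCondition d k bs
ParkingCondition-↭ {d} as↭bs cond m m≤dk = subst (λ c → m ≤ d * c) (count-↭ (_≤? m) as↭bs) (cond m m≤dk)

ParkingCondition⇒≤dk : ∀ {d k as} → 1 ≤ d → length as ≡ k → ParkingCondition d k as → All (_≤ d * k) as
ParkingCondition⇒≤dk {d} {k} {as} d≥1 length≡k cond = count≥length⇒All (_≤? d * k) as
  (subst (_≤ count (_≤? d * k) as) (sym length≡k) (*-cancelˡ-≤ d {{>-nonZero d≥1}} (cond (d * k) ≤-refl)))

module _ {m : ℕ} where

  lookup≤⇒<count : ∀ {xs} → AllPairs _≤_ xs → ∀ t → lookup xs t ≤ m → toℕ t < count (_≤? m) xs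
  lookup≤⇒<count {x ∷ xs} _ zero x≤m rewrite filter-accept (_≤? m) {xs = xs} x≤m = s≤s z≤n
  lookup≤⇒<count {x ∷ xs} (x≤xs ∷ sorted) (suc t) xt≤m
    rewrite filter-accept (_≤? m) {xs = xs} (≤-trans (All.lookup x≤xs (∈-lookup t)) xt≤m) =
    s≤s (lookup≤⇒<count sorted t xt≤m)

  <lookup⇒count≤ : ∀ {xs} → AllPairs _≤_ xs → ∀ t → m < lookup xs t → count (_≤? m) xs ≤ toℕ t
  <lookup⇒count≤ {x ∷ xs} (x≤xs ∷ _) zero m<x =
    ≤-reflexive (cong length
      (filter-none (_≤? m) (<⇒≱ m<x ∷ All.map (λ x≤y → <⇒≱ (<-≤-trans m<x x≤y)) x≤xs)))
  <lookup⇒count≤ {x ∷ xs} (_ ∷ sorted) (suc t) m<xt =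
    ≤-trans (count-∷-≤ (_≤? m) x xs) (s≤s (<lookup⇒count≤ sorted t m<xt))

module _ {d k : ℕ} {a : Vec ℕ k} where

  IsParkingFunction⇒ParkingCondition : IsParkingFunction d k a → ParkingCondition d k (toList a)
  IsParkingFunction⇒ParkingCondition PF = ParkingCondition-↭ {d} {k} sortedPerm sorted-condition
    where
    open IsParkingFunction PF
    length-sorted : length sorted ≡ k
    length-sorted = trans (↭-length sortedPerm) (length-toList a)
    sorted-condition : ParkingCondition d k sorted
    sorted-condition m m≤dk with m ≤? d * count (_≤? m) sorted
    ... | yes m≤dL = m≤dL
    ... | no m≰dL = ⊥-elim (<-irrefl (toℕ-fromℕ< L<len) (lookup≤⇒<count sorted↗ t st≤m))
      where
      L = count (_≤? m) sorted
      sorted↗ = Linked⇒AllPairs ≤-trans sortedNondecr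
      dL<m : d * L < m
      dL<m = ≰⇒> m≰dL
      L<len : L < length sorted
      L<len = ≤∧≢⇒< (length-filter (_≤? m) sorted) λ L≡len →
        <-irrefl refl (<-≤-trans dL<m (subst (λ c → m ≤ d * c) (sym (trans L≡len length-sorted)) m≤dk))
      t = fromℕ< L<len
      st≤m : lookup sorted t ≤ m
      st≤m = ≤-trans (bound t)
        (subst (λ c → d * c + 1 ≤ m) (sym (toℕ-fromℕ< L<len)) (subst (_≤ m) (+-comm 1 (d * L)) dL<m))

  ParkingCondition⇒IsParkingFunction : 1 ≤ d → All (1 ≤_) (toList a) → ParkingCondition d k (toList a) →
                                        IsParkingFunction d k a
  ParkingCondition⇒IsParkingFunction d≥1 positive cond = record
    { positive = positive
    ; sorted = sorted
    ; sortedPerm = sort-↭ (toList a)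
    ; sortedNondecr = sort-↗ (toList a)
    ; bound = bound
    }
    where
    open Sort ≤-decTotalOrder using (sort; sort-↭; sort-↗)
    sorted = sort (toList a)
    bound : ∀ t → lookup sorted t ≤ d * toℕ t + 1
    bound t with lookup sorted t ≤? d * toℕ t + 1
    ... | yes st≤M = st≤M
    ... | no st≰M = ⊥-elim (<-irrefl refl (begin-strict
          M                                ≤⟨ ParkingCondition-↭ {d} {k} (↭-sym (sort-↭ (toList a))) cond M M≤dk ⟩
          d * count (_≤? M) sorted
            ≤⟨ *-monoʳ-≤ d (<lookup⇒count≤ (Linked⇒AllPairs ≤-trans (sort-↗ (toList a))) t (≰⇒> st≰M)) ⟩
          d * toℕ t                        <⟨ m<m+n (d * toℕ t) (s≤s z≤n) ⟩
          M                                ∎))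
      where
      open ≤-Reasoning
      M = d * toℕ t + 1
      t<k : toℕ t < k
      t<k = subst (toℕ t <_) (trans (↭-length (sort-↭ (toList a))) (length-toList a)) (toℕ<n t)
      M≤dk : M ≤ d * k
      M≤dk = begin
        d * toℕ t + 1    ≤⟨ +-monoʳ-≤ (d * toℕ t) d≥1 ⟩
        d * toℕ t + d    ≡⟨ +-comm (d * toℕ t) d ⟩
        d + d * toℕ t    ≡⟨ *-suc d (toℕ t) ⟨
        d * suc (toℕ t)  ≤⟨ *-monoʳ-≤ d t<k ⟩
        d * k            ∎

-- The sibling lists forced by a parking function

module Siblings (d k : ℕ) where

  block : Fin k → List (Label d k)
  block i = map (λ j → just (i , j)) (allFin d)

  allLabels : List (Label d k)
  allLabels = concatMap block (descendingFin k)

  parentOf : (Fin k → ℕ) → Label d k → ℕ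
  parentOf A nothing = 0
  parentOf A (just (i , _)) = A i

  -- left to right, the children of the vertex with DFS number m in the tree of A
  siblings : (Fin k → ℕ) → ℕ → List (Label d k)
  siblings A m = filter (λ x → parentOf A x ≟ m) allLabels

  siblingCodes : (Fin k → ℕ) → List (List (Label d k))
  siblingCodes A = applyUpTo (λ w → siblings A (suc w)) (d * k + 1)

  data _≺_ : Label d k → Label d k → Set where
    across : ∀ {i i' j j'} → toℕ i' < toℕ i → just (i , j) ≺ just (i' , j')
    within : ∀ {i j j'} → toℕ j < toℕ j' → just (i , j) ≺ just (i , j')

  ≺-irrefl : ∀ {x} → ¬ x ≺ x
  ≺-irrefl (across i<i) = <-irrefl refl i<i
  ≺-irrefl (within j<j) = <-irrefl refl j<j

  ≺-asym : Asymmetric _≺_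
  ≺-asym (across i'<i) (across i<i') = <-asym i'<i i<i'
  ≺-asym (across i<i) (within _) = <-irrefl refl i<i
  ≺-asym (within _) (across i<i) = <-irrefl refl i<i
  ≺-asym (within j<j') (within j'<j) = <-asym j<j' j'<j

  ≺-adjacent : ∀ {i j j' z} → toℕ j' ≡ suc (toℕ j) → just (i , j) ≺ z → ¬ z ≺ just (i , j')
  ≺-adjacent _ (across i″<i) (across i<i″) = <-asym i″<i i<i″
  ≺-adjacent _ (across i<i) (within _) = <-irrefl refl i<i
  ≺-adjacent _ (within _) (across i<i) = <-irrefl refl i<i
  ≺-adjacent j'≡1+j (within j<j″) (within j″<j') = <⇒≱ j<j″ (≤-pred (subst (_ <_) j'≡1+j j″<j'))

  ∈-allLabels : ∀ i j → just (i , j) ∈ allLabels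
  ∈-allLabels i j = ∈-concatMap⁺ block (lose (∈-descendingFin i) (∈-map⁺ _ (∈-allFin j)))

  allLabels-just : ∀ {x} → x ∈ allLabels → Σ (Fin k) λ i → Σ (Fin d) λ j → x ≡ just (i , j)
  allLabels-just x∈ with Any.satisfied (∈-concatMap⁻ block {xs = descendingFin k} x∈)
  ... | i , x∈block with ∈-map⁻ (λ j → just (i , j)) x∈block
  ... | j , _ , x≡ = i , j , x≡

  allLabels-sorted : AllPairs _≺_ allLabels
  allLabels-sorted = blocks-sorted (descendingFin-decreasing k)
    where
    blocks-sorted : ∀ {is} → AllPairs (λ i i' → toℕ i' < toℕ i) is → AllPairs _≺_ (concatMap block is)
    blocks-sorted [] = []
    blocks-sorted {i ∷ is} (i>is ∷ decreasing) =
      AllPairsₚ.++⁺ (AllPairsₚ.map⁺ (AllPairs.map within (allFin-increasing d))) (blocks-sorted decreasing)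
        (All.tabulate λ x∈block → All.tabulate λ y∈rest → earlier-block x∈block y∈rest)
      where
      earlier-block : ∀ {x y} → x ∈ block i → y ∈ concatMap block is → x ≺ y
      earlier-block x∈ y∈ with ∈-map⁻ (λ j → just (i , j)) x∈ | find (∈-concatMap⁻ block {xs = is} y∈)
      ... | j , _ , refl | i' , i'∈is , y∈block with ∈-map⁻ (λ j → just (i' , j)) y∈block
      ... | j' , _ , refl = across (All.lookup i>is i'∈is)

  module _ {A : Fin k → ℕ} where

    ∈-siblings⁺ : ∀ {m} i j → A i ≡ m → just (i , j) ∈ siblings A m
    ∈-siblings⁺ {m} i j Ai≡m = ∈-filter⁺ (λ x → parentOf A x ≟ m) (∈-allLabels i j) Ai≡m

    ∈-siblings⁻ : ∀ {m x} → x ∈ siblings A m → Σ (Fin k) λ i → Σ (Fin d) λ j → x ≡ just (i , j) × A i ≡ m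
    ∈-siblings⁻ {m} x∈ with ∈-filter⁻ (λ x → parentOf A x ≟ m) {xs = allLabels} x∈
    ... | x∈all , parent≡m with allLabels-just x∈all
    ... | i , j , refl = i , j , refl , parent≡m

    ∈-siblings⇒parent : ∀ {m i j} → just (i , j) ∈ siblings A m → A i ≡ m
    ∈-siblings⇒parent x∈ with ∈-siblings⁻ x∈
    ... | _ , _ , refl , Ai≡m = Ai≡m

    siblings-sorted : ∀ m → AllPairs _≺_ (siblings A m)
    siblings-sorted m = AllPairsₚ.filter⁺ (λ x → parentOf A x ≟ m) allLabels-sorted

    any-isBlockOf-siblings⁻ : ∀ {i m} → Bool.T (any (isBlockOf i) (siblings A m)) → A i ≡ m
    any-isBlockOf-siblings⁻ {i} {m} hasBlock with find (Anyₚ.any⁻ (isBlockOf i) (siblings A m) hasBlock)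
    ... | x , x∈ , isBlock with ∈-siblings⁻ x∈
    ... | i' , j , refl , Ai'≡m rewrite toWitness isBlock = Ai'≡m

    any-isBlockOf-siblings⁺ : 1 ≤ d → ∀ {i m} → A i ≡ m → Bool.T (any (isBlockOf i) (siblings A m))
    any-isBlockOf-siblings⁺ d≥1 {i} Ai≡m =
      Anyₚ.any⁺ (isBlockOf i) (lose (∈-siblings⁺ i (fromℕ< d≥1) Ai≡m) (fromWitness {a? = i Fin.≟ i} refl))

    length-filter-blocks : {P : ℕ → Set} (P? : Decidable P) (is : List (Fin k)) →
      length (filter (P? ∘ parentOf A) (concatMap block is)) ≡ d * count P? (map A is)
    length-filter-blocks P? [] = sym (*-zeroʳ d)
    length-filter-blocks P? (i ∷ is) with P? (A i)
    ... | yes PAi = begin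
      count Q (block i ++ concatMap block is)
        ≡⟨ count-++ Q (block i) (concatMap block is) ⟩
      count Q (block i) + count Q (concatMap block is)
        ≡⟨ cong₂ _+_ (cong length (filter-all Q (Allₚ.map⁺ (All.universal (λ _ → PAi) (allFin d)))))
                     (length-filter-blocks P? is) ⟩
      length (block i) + d * count P? (map A is)
        ≡⟨ cong (_+ d * count P? (map A is)) (trans (length-map _ (allFin d)) (length-tabulate id)) ⟩
      d + d * count P? (map A is)
        ≡⟨ *-suc d _ ⟨
      d * suc (count P? (map A is)) ∎
      where
      open ≡-Reasoning
      Q = P? ∘ parentOf A
    ... | no ¬PAi = begin
      count Q (block i ++ concatMap block is)
        ≡⟨ count-++ Q (block i) (concatMap block is) ⟩
      count Q (block i) + count Q (concatMap block is)
        ≡⟨ cong₂ _+_ (cong length (filter-none Q (Allₚ.map⁺ (All.universal (λ _ → ¬PAi) (allFin d)))))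
                     (length-filter-blocks P? is) ⟩
      d * count P? (map A is) ∎
      where
      open ≡-Reasoning
      Q = P? ∘ parentOf A

    siblings-prefix-↭ : (∀ i → 1 ≤ A i) → ∀ m →
      concat (applyUpTo (λ w → siblings A (suc w)) m) ↭ filter (λ x → parentOf A x ≤? m) allLabels
    siblings-prefix-↭ positive = concat-applyUpTo-filter-↭ (parentOf A) (All.tabulate parent-positive)
      where
      parent-positive : ∀ {x} → x ∈ allLabels → 1 ≤ parentOf A x
      parent-positive x∈ with allLabels-just x∈
      ... | i , j , refl = positive i

    siblings-prefix-length : (∀ i → 1 ≤ A i) → ∀ m →
      sum (map length (applyUpTo (λ w → siblings A (suc w)) m)) ≡ d * count (_≤? m) (map A (descendingFin k))
    siblings-prefix-length positive m =
      trans (sum-map-length (applyUpTo (λ w → siblings A (suc w)) m))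
            (trans (↭-length (siblings-prefix-↭ positive m)) (length-filter-blocks (_≤? m) (descendingFin k)))

  siblings-cong : ∀ {A A'} → (∀ i → A i ≡ A' i) → ∀ m → siblings A m ≡ siblings A' m
  siblings-cong {A} {A'} A≗A' m =
    filter-≐ (λ x → parentOf A x ≟ m) (λ x → parentOf A' x ≟ m)
      ((λ {x} → to {x}) , (λ {x} → from {x})) allLabels
    where
    to : ∀ {x} → parentOf A x ≡ m → parentOf A' x ≡ m
    to {nothing} = id
    to {just (i , _)} = trans (sym (A≗A' i))
    from : ∀ {x} → parentOf A' x ≡ m → parentOf A x ≡ m
    from {nothing} = id
    from {just (i , _)} = trans (A≗A' i)

  siblingCodes-cong : ∀ {A A'} → (∀ i → A i ≡ A' i) → siblingCodes A ≡ siblingCodes A'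
  siblingCodes-cong A≗A' = applyUpTo-cong (siblings-cong A≗A' ∘ suc) (d * k + 1)

-- Parking trees are determined by their sibling lists

module _ {d k : ℕ} where
  open Siblings d k

  hasChildBlock≡any : ∀ i (v : LTree d k) → hasChildBlock i v ≡ any (isBlockOf i) (code v)
  hasChildBlock≡any i v = cong or (map-∘ (children v))

  siblingCodes⇒parentDFS : 1 ≤ d → ∀ {T A} → codes T ≡ siblingCodes A →
    (∀ i → 1 ≤ A i) → (∀ i → A i ≤ d * k + 1) → ∀ i → parentDFS T i ≡ A i
  siblingCodes⇒parentDFS d≥1 {T} {A} codes≡ positive bounded i = begin
    suc (firstIndex (hasChildBlock i) (preorder T))
      ≡⟨ cong suc (firstIndex-map code (preorder T) (hasChildBlock≡any i)) ⟩
    suc (firstIndex (any (isBlockOf i)) (codes T))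
      ≡⟨ cong (suc ∘ firstIndex (any (isBlockOf i))) codes≡ ⟩
    suc (firstIndex (any (isBlockOf i)) (siblingCodes A))
      ≡⟨ cong suc (firstIndex-applyUpTo (any (isBlockOf i)) (λ w → siblings A (suc w))
                     w<n (any-isBlockOf-siblings⁺ d≥1 (sym 1+w≡)) earlier) ⟩
    suc w
      ≡⟨ 1+w≡ ⟩
    A i ∎
    where
    open ≡-Reasoning
    w = A i ∸ 1
    1+w≡ : suc w ≡ A i
    1+w≡ = trans (+-comm 1 w) (m∸n+n≡m (positive i))
    w<n : w < d * k + 1
    w<n = subst (_≤ d * k + 1) (sym 1+w≡) (bounded i)
    earlier : ∀ {u} → u < w → ¬ Bool.T (any (isBlockOf i) (siblings A (suc u)))
    earlier u<w hasBlock = <-irrefl (sym (any-isBlockOf-siblings⁻ hasBlock)) (subst (suc _ <_) 1+w≡ (s≤s u<w))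

  Consecutive : List (LTree d k) → Set
  Consecutive cs = ∀ (p : Fin (length cs)) (i : Fin k) (j j' : Fin d) →
    label (lookup cs p) ≡ just (i , j) → toℕ j' ≡ suc (toℕ j) →
    Σ (Fin (length cs)) λ q → (toℕ q ≡ suc (toℕ p)) × (label (lookup cs q) ≡ just (i , j'))

  consecutive-chain : ∀ {cs} → Consecutive cs → ∀ {p i j} → label (lookup cs p) ≡ just (i , j) →
    ∀ {j'} → toℕ j ≤ toℕ j' →
    Σ (Fin (length cs)) λ q → toℕ q ≡ toℕ p + (toℕ j' ∸ toℕ j) × label (lookup cs q) ≡ just (i , j')
  consecutive-chain {cs} consecutive {p} {i} {j} e {j'} j≤j' with chain (toℕ j' ∸ toℕ j) j+t<d
    where
    j+t<d : toℕ j + (toℕ j' ∸ toℕ j) < d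
    j+t<d = subst (_< d) (sym (m+[n∸m]≡n j≤j')) (toℕ<n j')
    chain : ∀ t (j+t<d : toℕ j + t < d) →
            Σ (Fin (length cs)) λ q → toℕ q ≡ toℕ p + t × label (lookup cs q) ≡ just (i , fromℕ< j+t<d)
    chain zero j<d = p , sym (+-identityʳ (toℕ p)) ,
      trans e (cong (λ j → just (i , j)) (toℕ-injective (sym (trans (toℕ-fromℕ< j<d) (+-identityʳ (toℕ j))))))
    chain (suc t) j+1+t<d with chain t (<-trans (+-monoʳ-< (toℕ j) (n<1+n t)) j+1+t<d)
    ... | q , q≡ , e′ with consecutive q i _ (fromℕ< j+1+t<d) e′
                             (trans (toℕ-fromℕ< _) (trans (+-suc (toℕ j) t) (cong suc (sym (toℕ-fromℕ< _)))))
    ... | q′ , q′≡ , e″ = q′ , trans q′≡ (trans (cong suc q≡) (sym (+-suc (toℕ p) t))) , e″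
  ... | q , q≡ , e′ =
    q , q≡ , trans e′ (cong (λ j → just (i , j)) (toℕ-injective (trans (toℕ-fromℕ< _) (m+[n∸m]≡n j≤j'))))

  module ParkingTreeCodes (d≥1 : 1 ≤ d) {T : LTree d k} (PT : IsParkingTree d k T) where
    open IsParkingTree PT

    private
      VS = preorder T
      j₀ : Fin d
      j₀ = fromℕ< d≥1

    ChildAt : Fin (length VS) → Label d k → Set
    ChildAt u x = Σ (Fin (length (children (lookup VS u)))) λ p → label (lookup (children (lookup VS u)) p) ≡ x

    childLabelOnce : ∀ i j → count (λ c → label c ≟L just (i , j)) (concatMap children VS) ≡ 1
    childLabelOnce i j = trans (sym (countLabel-children T (just (i , j)) root≢)) (labelOnce i j)
      where
      root≢ : label T ≢ just (i , j)
      root≢ root≡ with () ← trans (sym rootLabel) root≡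

    parent-unique : ∀ {u u' i j} → ChildAt u (just (i , j)) → ChildAt u' (just (i , j)) → u ≡ u'
    parent-unique {i = i} {j} (_ , e) (_ , e') =
      concatMap-lookup-unique (λ c → label c ≟L just (i , j)) children VS (≤-reflexive (childLabelOnce i j)) e e'

    position-unique : ∀ {u i j p q} → label (lookup (children (lookup VS u)) p) ≡ just (i , j) →
                      label (lookup (children (lookup VS u)) q) ≡ just (i , j) → p ≡ q
    position-unique {u} {i} {j} e e' = lookup-unique (λ c → label c ≟L just (i , j)) (children (lookup VS u))
      (≤-trans (count-≤-concatMap (λ c → label c ≟L just (i , j)) children VS {u}) (≤-reflexive (childLabelOnce i j)))
      e e'

    childLabel-just : ∀ u p →
      Σ (Fin k) λ i → Σ (Fin d) λ j → label (lookup (children (lookup VS u)) p) ≡ just (i , j)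
    childLabel-just u p with label (lookup (children (lookup VS u)) p) in e
    ... | nothing = ⊥-elim (nonRootLabel (lookup VS u) (∈-lookup u) _ (∈-lookup p) e)
    ... | just (i , j) = i , j , refl

    private
      firstOfBlock : ∀ i → Any (Any (λ c → label c ≡ just (i , j₀)) ∘ children) VS
      firstOfBlock i = Anyₚ.map⁻ (Anyₚ.concat⁻ (map children VS)
        (count>0⇒Any (λ c → label c ≟L just (i , j₀)) (concatMap children VS)
          (≤-reflexive (sym (childLabelOnce i j₀)))))

    parentPos : Fin k → Fin (length VS)
    parentPos i = Any.index (firstOfBlock i)

    firstChild : ∀ i → ChildAt (parentPos i) (just (i , j₀))
    firstChild i = Any.index (Anyₚ.lookup-index (firstOfBlock i)) , Anyₚ.lookup-index (Anyₚ.lookup-index (firstOfBlock i))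

    blockAtParent : ∀ i j → ChildAt (parentPos i) (just (i , j))
    blockAtParent i j = proj₁ chained , proj₂ (proj₂ chained)
      where
      chained = consecutive-chain {cs = children (lookup VS (parentPos i))}
        (consecutive (lookup VS (parentPos i)) (∈-lookup (parentPos i))) (proj₂ (firstChild i))
        (subst (_≤ toℕ j) (sym (toℕ-fromℕ< d≥1)) z≤n)

    sameParent : ∀ {u i j} → ChildAt u (just (i , j)) → u ≡ parentPos i
    sameParent {i = i} {j} child = parent-unique child (blockAtParent i j)

    parentNumber : Fin k → ℕ
    parentNumber i = suc (toℕ (parentPos i))

    code⊆siblings : ∀ u {x} → x ∈ code (lookup VS u) → x ∈ siblings parentNumber (suc (toℕ u))
    code⊆siblings u x∈ with ∈-map-lookup⁻ label x∈
    ... | p , refl with childLabel-just u p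
    ... | i , j , e rewrite e = ∈-siblings⁺ i j (cong (suc ∘ toℕ) (sym (sameParent (p , e))))

    siblings⊆code : ∀ u {x} → x ∈ siblings parentNumber (suc (toℕ u)) → x ∈ code (lookup VS u)
    siblings⊆code u x∈ with ∈-siblings⁻ x∈
    ... | i , j , refl , parent≡ with toℕ-injective (suc-injective parent≡)
    ... | refl = subst (_∈ code (lookup VS (parentPos i))) (proj₂ (blockAtParent i j))
                       (∈-map⁺ label (∈-lookup (proj₁ (blockAtParent i j))))

    siblingOrder : ∀ u {p q i i' j j'} → toℕ p < toℕ q →
                   label (lookup (children (lookup VS u)) p) ≡ just (i , j) →
                   label (lookup (children (lookup VS u)) q) ≡ just (i' , j') → just (i , j) ≺ just (i' , j')
    siblingOrder u {p} {q} {i} {i'} {j} {j'} p<q ep eq with <-cmp (toℕ i) (toℕ i')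
    ... | tri< i<i' _ _ = ⊥-elim (<-asym p<q (ordering (lookup VS u) (∈-lookup u) p q i i' j j' ep eq i<i'))
    ... | tri> _ _ i'<i = across i'<i
    ... | tri≈ _ i≡i' _ with toℕ-injective i≡i'
    ... | refl with toℕ j <? toℕ j'
    ...   | yes j<j' = within j<j'
    -- otherwise the block continues from i_j' at q to a second occurrence of i_j, at or after q
    ...   | no j≮j' = ⊥-elim (<⇒≱ p<q
      (subst (λ r → toℕ q ≤ toℕ r) (sym (position-unique ep (proj₂ (proj₂ chained))))
             (subst (toℕ q ≤_) (sym (proj₁ (proj₂ chained))) (m≤m+n _ _))))
      where
      chained = consecutive-chain {cs = children (lookup VS u)} (consecutive (lookup VS u) (∈-lookup u)) eq (≮⇒≥ j≮j')

    children-sorted : ∀ u → AllPairs _≺_ (code (lookup VS u))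
    children-sorted u = AllPairsₚ.map⁺ (AllPairs-lookup⁺ (children (lookup VS u)) ordered)
      where
      ordered : ∀ {p q} → toℕ p < toℕ q →
                label (lookup (children (lookup VS u)) p) ≺ label (lookup (children (lookup VS u)) q)
      ordered {p} {q} p<q with childLabel-just u p | childLabel-just u q
      ... | i , j , ep | i' , j' , eq = subst₂ _≺_ (sym ep) (sym eq) (siblingOrder u p<q ep eq)

    codes≡siblingCodes : codes T ≡ siblingCodes parentNumber
    codes≡siblingCodes = trans
      (map≡applyUpTo code (λ w → siblings parentNumber (suc w)) VS λ u →
        sorted-≡ ≺-irrefl ≺-asym (children-sorted u) (siblings-sorted _) (code⊆siblings u) (siblings⊆code u))
      (cong (applyUpTo (λ w → siblings parentNumber (suc w))) size)

    parentDFS≗parentNumber : ∀ i → parentDFS T i ≡ parentNumber i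
    parentDFS≗parentNumber = siblingCodes⇒parentDFS d≥1 codes≡siblingCodes (λ _ → s≤s z≤n)
      (λ i → subst (parentNumber i ≤_) size (toℕ<n (parentPos i)))

  IsParkingTree⇒siblingCodes : 1 ≤ d → ∀ {T} → IsParkingTree d k T → codes T ≡ siblingCodes (parentDFS T)
  IsParkingTree⇒siblingCodes d≥1 PT = trans codes≡siblingCodes (siblingCodes-cong (sym ∘ parentDFS≗parentNumber))
    where open ParkingTreeCodes d≥1 PT

  module SiblingCodesTree {T : LTree d k} {A : Fin k → ℕ}
    (root≡ : label T ≡ nothing) (codes≡ : codes T ≡ siblingCodes A)
    (positive : ∀ i → 1 ≤ A i) (bounded : ∀ i → A i ≤ d * k + 1) where

    size : length (preorder T) ≡ d * k + 1
    size = trans (sym (length-map code (preorder T))) (trans (cong length codes≡) (length-applyUpTo _ (d * k + 1)))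

    vertexCode : ∀ {v} → v ∈ preorder T → Σ ℕ λ m → code v ≡ siblings A m
    vertexCode {v} v∈ with ∈-applyUpTo⁻ (λ w → siblings A (suc w)) (subst (code v ∈_) codes≡ (∈-map⁺ code v∈))
    ... | w , _ , code≡ = suc w , code≡

    module Children {v} (v∈ : v ∈ preorder T) where
      m = proj₁ (vertexCode v∈)
      code≡ = proj₂ (vertexCode v∈)
      sorted : AllPairs (λ c c' → label c ≺ label c') (children v)
      sorted = AllPairsₚ.map⁻ (subst (AllPairs _≺_) (sym code≡) (siblings-sorted m))
      order : ∀ {p q} → label (lookup (children v) p) ≺ label (lookup (children v) q) → toℕ p < toℕ q
      order = AllPairs-lookup-< {R = λ c c' → label c ≺ label c'} ≺-irrefl ≺-asym sorted

    childrenDiv : ∀ v → v ∈ preorder T → d ∣ length (children v)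
    childrenDiv v v∈ = subst (d ∣_) (sym (trans (sym (length-map label (children v))) (trans (cong length code≡)
        (length-filter-blocks (_≟ m) (descendingFin k))))) (m∣m*n _)
      where open Children v∈

    nonRootLabel : ∀ v → v ∈ preorder T → ∀ c → c ∈ children v → label c ≢ nothing
    nonRootLabel v v∈ c c∈ label≡nothing
      with ∈-siblings⁻ (subst (label c ∈_) (Children.code≡ v∈) (∈-map⁺ label c∈))
    ... | _ , _ , label≡ , _ = case trans (sym label≡nothing) label≡ of λ ()

    labelOnce : ∀ i j → countLabel T (just (i , j)) ≡ 1
    labelOnce i j = begin
      countLabel T x
        ≡⟨ countLabel-children T x (λ root≡x → case trans (sym root≡) root≡x of λ ()) ⟩
      length (filter (λ c → label c ≟L x) (concatMap children (preorder T)))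
        ≡⟨ count-map (_≟L x) label (concatMap children (preorder T)) ⟨
      count (_≟L x) (map label (concatMap children (preorder T)))
        ≡⟨ cong (count (_≟L x)) (trans (map-label-children T) (cong concat codes≡)) ⟩
      count (_≟L x) (concat (siblingCodes A))
        ≡⟨ count-↭ (_≟L x) (siblings-prefix-↭ positive (d * k + 1)) ⟩
      count (_≟L x) (filter (λ y → parentOf A y ≤? d * k + 1) allLabels)
        ≡⟨ cong (count (_≟L x)) (filter-all (λ y → parentOf A y ≤? d * k + 1) (All.tabulate parent-bounded)) ⟩
      count (_≟L x) allLabels
        ≡⟨ count-sorted-∈ ≺-irrefl _≟L_ allLabels-sorted (∈-allLabels i j) ⟩
      1 ∎
      where
      open ≡-Reasoning
      x = just (i , j)
      parent-bounded : ∀ {y} → y ∈ allLabels → parentOf A y ≤ d * k + 1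
      parent-bounded y∈ with allLabels-just y∈
      ... | i' , _ , refl = bounded i'

    consecutive : ∀ v → v ∈ preorder T → Consecutive (children v)
    consecutive v v∈ p i j j' ep j'≡ = q , adjacent , eq
      where
      open Children v∈
      j∈ : just (i , j) ∈ siblings A m
      j∈ = subst (_∈ siblings A m) ep (subst (label (lookup (children v) p) ∈_) code≡ (∈-map⁺ label (∈-lookup p)))
      found = ∈-map-lookup⁻ label
        (subst (just (i , j') ∈_) (sym code≡) (∈-siblings⁺ i j' (∈-siblings⇒parent j∈)))
      q = proj₁ found
      eq = proj₂ found
      adjacent : toℕ q ≡ suc (toℕ p)
      adjacent = AllPairs-lookup-adjacent {R = λ c c' → label c ≺ label c'} ≺-irrefl ≺-asym sorted
        (subst₂ _≺_ (sym ep) (sym eq) (within (subst (toℕ j <_) (sym j'≡) (n<1+n _))))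
        (λ p≺z z≺q → ≺-adjacent j'≡ (subst (_≺ _) ep p≺z) (subst (_ ≺_) eq z≺q))

    ordering : ∀ v → v ∈ preorder T → ∀ (p q : Fin (length (children v))) (i i' : Fin k) (j j' : Fin d) →
               label (lookup (children v) p) ≡ just (i , j) → label (lookup (children v) q) ≡ just (i' , j') →
               toℕ i < toℕ i' → toℕ q < toℕ p
    ordering v v∈ p q i i' j j' ep eq i<i' = Children.order v∈ (subst₂ _≺_ (sym eq) (sym ep) (across i<i'))

  siblingCodes⇒IsParkingTree : ∀ {T A} → label T ≡ nothing → codes T ≡ siblingCodes A →
    (∀ i → 1 ≤ A i) → (∀ i → A i ≤ d * k + 1) → IsParkingTree d k T
  siblingCodes⇒IsParkingTree root≡ codes≡ positive bounded = record
    { size = size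
    ; childrenDiv = childrenDiv
    ; rootLabel = root≡
    ; nonRootLabel = nonRootLabel
    ; labelOnce = labelOnce
    ; consecutive = consecutive
    ; ordering = ordering
    }
    where open SiblingCodesTree root≡ codes≡ positive bounded

module _ (d k : ℕ) (d≥1 : 1 ≤ d) where
  open Siblings d k

  private
    ≤dk⇒<n : ∀ {m} → m ≤ d * k → m < d * k + 1
    ≤dk⇒<n {m} m≤dk = subst (m <_) (+-comm 1 (d * k)) (s≤s m≤dk)

    length-siblingDegrees : ∀ A → length (map length (siblingCodes A)) ≡ d * k + 1
    length-siblingDegrees A = trans (length-map length (siblingCodes A)) (length-applyUpTo _ (d * k + 1))

  siblingCodes-prefix-sum : ∀ {A} → (∀ i → 1 ≤ A i) → ∀ {m} → m ≤ d * k + 1 →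
    sum (take m (map length (siblingCodes A))) ≡ d * count (_≤? m) (map A (descendingFin k))
  siblingCodes-prefix-sum {A} positive {m} m≤n = begin
    sum (take m (map length (siblingCodes A)))                   ≡⟨ cong sum (take-map m (siblingCodes A)) ⟩
    sum (map length (take m (siblingCodes A)))                   ≡⟨ cong (sum ∘ map length) (take-applyUpTo _ m≤n) ⟩
    sum (map length (applyUpTo (λ w → siblings A (suc w)) m))    ≡⟨ siblings-prefix-length positive m ⟩
    d * count (_≤? m) (map A (descendingFin k))                  ∎
    where open ≡-Reasoning

  siblingCodes-Łukasiewicz⇒ParkingCondition : ∀ {A} → (∀ i → 1 ≤ A i) →
    Łukasiewicz (map length (siblingCodes A)) → treeCount (map length (siblingCodes A)) ≡ 1 →
    ParkingCondition d k (map A (descendingFin k))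
  siblingCodes-Łukasiewicz⇒ParkingCondition {A} positive ł one m m≤dk = begin
    m
      ≤⟨ Łukasiewicz⇒prefix ł one m (subst (m <_) (sym (length-siblingDegrees A)) (≤dk⇒<n m≤dk)) ⟩
    sum (take m (map length (siblingCodes A)))
      ≡⟨ siblingCodes-prefix-sum positive (<⇒≤ (≤dk⇒<n m≤dk)) ⟩
    d * count (_≤? m) (map A (descendingFin k)) ∎
    where open ≤-Reasoning

  ParkingCondition⇒siblingCodes-Łukasiewicz : ∀ {A} → (∀ i → 1 ≤ A i) → (∀ i → A i ≤ d * k + 1) →
    ParkingCondition d k (map A (descendingFin k)) →
    Łukasiewicz (map length (siblingCodes A)) × treeCount (map length (siblingCodes A)) ≡ 1
  ParkingCondition⇒siblingCodes-Łukasiewicz {A} positive bounded cond = prefix⇒Łukasiewicz degrees total prefix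
    where
    degrees = map length (siblingCodes A)
    prefix : ∀ m → m < length degrees → m ≤ 0 + sum (take m degrees)
    prefix m m<len = begin
      m                                             ≤⟨ cond m (≤-pred (subst (m <_) (+-comm (d * k) 1) m<n)) ⟩
      d * count (_≤? m) (map A (descendingFin k))   ≡⟨ siblingCodes-prefix-sum positive (<⇒≤ m<n) ⟨
      sum (take m degrees)                          ∎
      where
      open ≤-Reasoning
      m<n = subst (m <_) (length-siblingDegrees A) m<len
    all-counted : count (_≤? d * k + 1) (map A (descendingFin k)) ≡ k
    all-counted = trans (cong length (filter-all (_≤? d * k + 1) (Allₚ.map⁺ (All.universal bounded (descendingFin k)))))
                        (trans (↭-length (map-descendingFin-↭ A)) (length-toList (Vec.tabulate A)))
    total : sum degrees + 1 ≡ length degrees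
    total = begin
      sum degrees + 1
        ≡⟨ cong (λ ds → sum ds + 1) (take-all (d * k + 1) degrees (≤-reflexive (length-siblingDegrees A))) ⟨
      sum (take (d * k + 1) degrees) + 1
        ≡⟨ cong (_+ 1) (siblingCodes-prefix-sum positive ≤-refl) ⟩
      d * count (_≤? d * k + 1) (map A (descendingFin k)) + 1
        ≡⟨ cong (λ c → d * c + 1) all-counted ⟩
      d * k + 1
        ≡⟨ length-siblingDegrees A ⟨
      length degrees ∎
      where open ≡-Reasoning

  toParkingFunction-parking : ∀ T → IsParkingTree d k T → IsParkingFunction d k (toParkingFunction T)
  toParkingFunction-parking T PT =
    ParkingCondition⇒IsParkingFunction d≥1 positive (ParkingCondition-↭ {d} {k} A↭a condition)
    where
    A = parentDFS T
    A↭a = map-descendingFin-↭ A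
    positive : All (1 ≤_) (toList (toParkingFunction T))
    positive = All-resp-↭ A↭a (Allₚ.map⁺ (All.universal (λ _ → s≤s z≤n) (descendingFin k)))
    łukasiewicz : Łukasiewicz (map length (siblingCodes A)) × treeCount (map length (siblingCodes A)) ≡ 1
    łukasiewicz = subst (λ Cs → Łukasiewicz (map length Cs) × treeCount (map length Cs) ≡ 1)
                        (IsParkingTree⇒siblingCodes d≥1 PT) (codes-Łukasiewicz T)
    condition : ParkingCondition d k (map A (descendingFin k))
    condition = siblingCodes-Łukasiewicz⇒ParkingCondition (λ _ → s≤s z≤n) (proj₁ łukasiewicz) (proj₂ łukasiewicz)

  toParkingFunction-injective : ∀ T T' → IsParkingTree d k T → IsParkingTree d k T' →
                                toParkingFunction T ≡ toParkingFunction T' → T ≡ T'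
  toParkingFunction-injective T T' PT PT' a≡a' =
    codes-injective T T' (trans (IsParkingTree.rootLabel PT) (sym (IsParkingTree.rootLabel PT'))) (begin
      codes T                          ≡⟨ IsParkingTree⇒siblingCodes d≥1 PT ⟩
      siblingCodes (parentDFS T)       ≡⟨ siblingCodes-cong parentDFS≗ ⟩
      siblingCodes (parentDFS T')      ≡⟨ IsParkingTree⇒siblingCodes d≥1 PT' ⟨
      codes T'                         ∎)
    where
    open ≡-Reasoning
    parentDFS≗ : ∀ i → parentDFS T i ≡ parentDFS T' i
    parentDFS≗ i = trans (sym (lookup∘tabulate (parentDFS T) i))
                         (trans (cong (λ a → Vec.lookup a i) a≡a') (lookup∘tabulate (parentDFS T') i))

  toParkingFunction-surjective : ∀ a → IsParkingFunction d k a →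
                                 Σ (LTree d k) λ T → IsParkingTree d k T × toParkingFunction T ≡ a
  toParkingFunction-surjective a PF =
    T , siblingCodes⇒IsParkingTree root≡ codes≡ positive bounded ,
    trans (tabulate-cong (siblingCodes⇒parentDFS d≥1 codes≡ positive bounded)) (tabulate∘lookup a)
    where
    A = Vec.lookup a
    A↭a : map A (descendingFin k) ↭ toList a
    A↭a = subst (map A (descendingFin k) ↭_) (cong toList (tabulate∘lookup a)) (map-descendingFin-↭ A)
    condition : ParkingCondition d k (map A (descendingFin k))
    condition = ParkingCondition-↭ {d} {k} (↭-sym A↭a) (IsParkingFunction⇒ParkingCondition PF)
    A∈ : ∀ i → A i ∈ map A (descendingFin k)
    A∈ i = ∈-map⁺ A (∈-descendingFin i)
    positive : ∀ i → 1 ≤ A i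
    positive i = All.lookup (All-resp-↭ (↭-sym A↭a) (IsParkingFunction.positive PF)) (A∈ i)
    bounded : ∀ i → A i ≤ d * k + 1
    bounded i = m≤n⇒m≤n+o 1
      (All.lookup (ParkingCondition⇒≤dk d≥1 (trans (↭-length A↭a) (length-toList a)) condition) (A∈ i))
    łukasiewicz = ParkingCondition⇒siblingCodes-Łukasiewicz positive bounded condition
    built = codes-surjective (siblingCodes A) (proj₁ łukasiewicz) (proj₂ łukasiewicz) nothing
    T = proj₁ built
    root≡ = proj₁ (proj₂ built)
    codes≡ = proj₂ (proj₂ built)

theorem8p9 : (d k : ℕ) → 1 ≤ d →
    ((T : LTree d k) → IsParkingTree d k T →
        IsParkingFunction d k (toParkingFunction T))
    × ((T T' : LTree d k) → IsParkingTree d k T → IsParkingTree d k T' →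
        toParkingFunction T ≡ toParkingFunction T' → T ≡ T')
    × ((a : Vec ℕ k) → IsParkingFunction d k a →
        Σ (LTree d k) (λ T → IsParkingTree d k T × (toParkingFunction T ≡ a)))
theorem8p9 d k d≥1 =
  toParkingFunction-parking d k d≥1 , toParkingFunction-injective d k d≥1 , toParkingFunction-surjective d k d≥1
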